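{- Let $(\mathcal{GO}_1,\dots,\mathcal{GO}_n)$ be a Pareto optimization problem with $\mathcal{GO}_i=\langle t_i,\prec_i,\phi_i\rangle$, and let $\mathcal{I}$ be a $\mathcal{GO}_{\mathcal{PO}}$-solution, where $\mathcal{GO}_{\mathcal{PO}}=\langle \mathit{tup}(t_1,\dots,t_n),\prec_{\mathcal{PO}},\phi_1\wedge\dots\wedge\phi_n\rangle$. Then $\mathcal{I}$ is a solution to the Pareto optimization problem $(\mathcal{GO}_1,\dots,\mathcal{GO}_n)$.
   Context: Fix a many-sorted first-order theory $\mathcal{T}$ (including a tuple datatype with $n$-ary constructor $\mathit{tup}$); all interpretations are $\mathcal{T}$-interpretations assigning values to all variables. A GOMT problem is a triple $\langle t,\prec,\phi\rangle$ with $t$ a term of sort $\sigma$, $\prec$ a strict partial order on values of sort $\sigma$ definable in $\mathcal{T}$, and $\phi$ a formula. For such a problem $\mathcal{GO}$: $\mathcal{I}$ is $\mathcal{GO}$-consistent if $\mathcal{I}\models\phi$; $\mathcal{I}<_{\mathcal{GO}}\mathcal{I}'$ if both are $\mathcal{GO}$-consistent and $t^{\mathcal{I}}\prec t^{\mathcal{I}'}$; a $\mathcal{GO}$-solution is a $\mathcal{GO}$-consistent interpretation not $\mathcal{GO}$-dominated by any interpretation. For a strict order $\prec_i$, $\preccurlyeq_i$ denotes its reflexive closure. A Pareto optimization problem is a sequence $(\mathcal{GO}_1,\dots,\mathcal{GO}_n)$ of GOMT problems $\mathcal{GO}_i=\langle t_i,\prec_i,\phi_i\rangle$. $\mathcal{I}$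 Pareto-dominates $\mathcal{I}'$ if both are $\mathcal{GO}_i$-consistent for every $i$, $t_i^{\mathcal{I}}\preccurlyeq_i t_i^{\mathcal{I}'}$ for all $i\in[1,n]$, and $t_j^{\mathcal{I}}\prec_j t_j^{\mathcal{I}'}$ for some $j\in[1,n]$. $\mathcal{I}$ is a solution to the Pareto problem iff it is $\mathcal{GO}_i$-consistent for each $i$ and no interpretation Pareto-dominates it. $\prec_{\mathcal{PO}}$ is the pointwise extension: $(a_1,\dots,a_n)\prec_{\mathcal{PO}}(b_1,\dots,b_n)$ iff $a_i\preccurlyeq_i b_i$ for all $i\in[1,n]$ and $a_j\prec_j b_j$ for some $j\in[1,n]$. -}

module Defs where

open import Data.Nat using (ℕ)
open import Data.Fin using (Fin)
open import Data.Product using (Σ; ∃; _×_; _,_)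
open import Relation.Nullary using (¬_)
open import Relation.Binary.PropositionalEquality using (_≡_)
open import Relation.Binary.Structures using (IsStrictPartialOrder)

-- Abstract semantics: the theory T is represented by a type `Interp` of
-- T-interpretations.  A term t of sort σ is represented by its evaluation
-- map Interp → ⟦σ⟧, a formula φ by its satisfaction predicate Interp → Set.

record GOMT (Interp : Set) : Set₁ where
  field
    Val     : Set
    term    : Interp → Val
    _≺_     : Val → Val → Set
    formula : Interp → Set

module _ {Interp : Set} (GO : GOMT Interp) where
  open GOMT GO

  Consistent : Interp → Set
  Consistent I = formula I

  _<GO_ : Interp → Interp → Set
  I <GO I' = Consistent I × Consistent I' × (term I ≺ term I')

  Solution : Interp → Set
  Solution I = Consistent I × (∀ I' → ¬ (I' <GO I))

data ReflClosure {A : Set} (R : A → A → Set) : A → A → Set where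
  incl : ∀ {a b} → R a b → ReflClosure R a b
  same : ∀ {a}   → ReflClosure R a a

ParetoProblem : Set → ℕ → Set₁
ParetoProblem Interp n = Fin n → GOMT Interp

module _ {Interp : Set} {n : ℕ} (P : ParetoProblem Interp n) where
  open GOMT

  AllConsistent : Interp → Set
  AllConsistent I = ∀ i → Consistent (P i) I

  ParetoDominates : Interp → Interp → Set
  ParetoDominates I I' =
    AllConsistent I × AllConsistent I' ×
    (∀ i → ReflClosure (_≺_ (P i)) (term (P i) I) (term (P i) I')) ×
    (∃ λ j → _≺_ (P j) (term (P j) I) (term (P j) I'))

  ParetoSolution : Interp → Set
  ParetoSolution I = AllConsistent I × (∀ I' → ¬ ParetoDominates I' I)

  TupVal : Set
  TupVal = (i : Fin n) → Val (P i)

  _≺PO_ : TupVal → TupVal → Set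
  a ≺PO b = (∀ i → ReflClosure (_≺_ (P i)) (a i) (b i)) × (∃ λ j → _≺_ (P j) (a j) (b j))

  GO-PO : GOMT Interp
  GO-PO = record
    { Val     = TupVal
    ; term    = λ I i → term (P i) I
    ; _≺_     = _≺PO_
    ; formula = λ I → ∀ i → formula (P i) I
    }

  StrictOrders : Set
  StrictOrders = ∀ i → IsStrictPartialOrder _≡_ (_≺_ (P i))

module Submission where

open import Defs
open import Data.Nat using (ℕ)
open import Data.Product using (_,_)

-- Pareto domination is literally domination for GO-PO.
ParetoDominates⇒<GO-PO : {Interp : Set} {n : ℕ} (P : ParetoProblem Interp n) →
  ∀ {I' I} → ParetoDominates P I' I → _<GO_ (GO-PO P) I' I
ParetoDominates⇒<GO-PO P (consistent' , consistent , weakly , strictly) =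
  consistent' , consistent , weakly , strictly

proposition2 : {Interp : Set} {n : ℕ} (P : ParetoProblem Interp n) →
    StrictOrders P →
    (I : Interp) → Solution (GO-PO P) I → ParetoSolution P I
proposition2 P _ I (consistent , undominated) =
  consistent , λ I' dominates → undominated I' (ParetoDominates⇒<GO-PO P dominates)
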